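{- (Transitive verbs.) Let $X_1,X_2$ be sets. For a permutation $\sigma$ of $\{1,2\}$ define maps $\mathcal C(X_1)\times\mathcal P(X_1\times X_2)\times\mathcal C(X_2)\to\mathbf 2$ by $$\mathrm{strat}^{2,\sigma}_A(Q_1,P,Q_2)=Q_{\sigma(1)}\big(\lambda x_{\sigma(1)}.\,Q_{\sigma(2)}(\lambda x_{\sigma(2)}.\,P(x_1,x_2))\big),$$ $$\mathrm{strat}^{2,\sigma}_B(Q_1,P,Q_2)=\mathrm{mos}^l_{X_1\times X_2}\big(\mathcal C(\rho_\sigma)(\mathrm{pu}^l(Q_{\sigma(1)},Q_{\sigma(2)})),\,P\big),$$ where $\rho_\sigma:X_{\sigma(1)}\times X_{\sigma(2)}\to X_1\times X_2$ is the bijection placing the $i$-th component in position $\sigma(i)$; and for $\epsilon\in\{l,r\}$ and $\epsilon''\in\{l,r\}$ define $$\mathrm{strat}^{2,\epsilon}_C(Q_1,P,Q_2)=\mathrm{ev}_{\mathrm{id}_{\mathbf 2}}\Big(\mathrm{cps}^\epsilon(\epsilon^r_{X_1})\big(Q_1,\ \mathrm{cps}^{\epsilon''}(\epsilon^l_{X_2})(\eta_{\mathcal P(X_1\times X_2)}(P),Q_2)\big)\Big).$$ Then, writing $\iota$ for the identity permutation and $\tau$ for the transposition, $\mathrm{strat}^{2,\sigma}_A=\mathrm{strat}^{2,\sigma}_B$ for both $\sigma$, and (for either choice of $\epsilon''$) $\mathrm{strat}^{2,\iota}_B=\mathrm{strat}^{2,l}_C$ and $\mathrm{strat}^{2,\tau}_B=\mathrm{strat}^{2,r}_C$.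 Thus Strategies A, B and C give the same semantics for sentences with a transitive verb, namely the two maps indexed by the two scope orders.
   Context: Let $\mathbf 2=\{\mathrm{true},\mathrm{false}\}$ and, for a set $X$, $\mathcal P(X)$ the set of functions $X\to\mathbf 2$. Continuation monad: $\mathcal C(X)=\mathcal P(\mathcal P(X))$; for $f:X\to Y$, $\mathcal C(f)(Q)=\lambda h_{:\mathcal P(Y)}.\,Q(h\circ f)$; unit $\eta_X(x)=\lambda h.\,h(x)$; multiplication $\mu_X(\mathcal F)=\lambda h.\,\mathcal F(\lambda D_{:\mathcal C(X)}.\,D(h))$. Pile-ups $\mathrm{pu}^l,\mathrm{pu}^r:\mathcal C(X)\times\mathcal C(Y)\to\mathcal C(X\times Y)$: $\mathrm{pu}^l(M,N)=\lambda c.\,M(\lambda x.\,N(\lambda y.\,c(x,y)))$, $\mathrm{pu}^r(M,N)=\lambda c.\,N(\lambda y.\,M(\lambda x.\,c(x,y)))$. For $g:X\times Y\to Z$, $\mathrm{cps}^\epsilon(g)=\mu_Z\circ\mathcal C(\eta_Z\circ g)\circ\mathrm{pu}^\epsilon:\mathcal C(X)\times\mathcal C(Y)\to\mathcal C(Z)$. Right evaluation $\epsilon^r_{X_1}:X_1\times\mathcal P(X_1)\to\mathbf 2$, $(x,h)\mapsto h(x)$. Left partial evaluation $\epsilon^l_{X_2}:\mathcal P(X_1\times X_2)\times X_2\to\mathcal P(X_1)$, $(c,y)\mapsto\lambda x_{:X_1}.\,c(x,y)$. $\mathrm{ev}_{\mathrm{id}_{\mathbf 2}}(R)=R(\mathrm{id}_{\mathbf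 2})$ for $R\in\mathcal C(\mathbf 2)$. $\mathrm{mos}^l_X(Q,c)=Q(c)$. Linguistically, $Q_1,Q_2$ interpret the subject and object quantifier phrases and $P$ the transitive verb; $\mathrm{strat}_A,\mathrm{strat}_B,\mathrm{strat}_C$ are the semantics given by the movement, polyadic and continuation-based strategies. -}

module Defs where

open import Data.Bool using (Bool)
open import Data.Product using (_×_; _,_)
open import Function using (_∘_; id)

𝟐 : Set
𝟐 = Bool

𝒫 : Set → Set
𝒫 X = X → 𝟐

𝒞 : Set → Set
𝒞 X = 𝒫 (𝒫 X)

𝒞map : {X Y : Set} → (X → Y) → 𝒞 X → 𝒞 Y
𝒞map f Q = λ h → Q (h ∘ f)

η : (X : Set) → X → 𝒞 X
η X x = λ h → h x

μ : (X : Set) → 𝒞 (𝒞 X) → 𝒞 X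
μ X F = λ h → F (λ D → D h)

data Side : Set where
  l r : Side

pu : Side → {X Y : Set} → 𝒞 X → 𝒞 Y → 𝒞 (X × Y)
pu l M N = λ c → M (λ x → N (λ y → c (x , y)))
pu r M N = λ c → N (λ y → M (λ x → c (x , y)))

cps : Side → {X Y Z : Set} → (X × Y → Z) → 𝒞 X × 𝒞 Y → 𝒞 Z
cps ε {Z = Z} g (M , N) = μ Z (𝒞map (η Z ∘ g) (pu ε M N))

evʳ : (X₁ : Set) → X₁ × 𝒫 X₁ → 𝟐
evʳ X₁ (x , h) = h x

evˡ : (X₁ X₂ : Set) → 𝒫 (X₁ × X₂) × X₂ → 𝒫 X₁
evˡ X₁ X₂ (c , y) = λ x → c (x , y)

ev-id : 𝒞 𝟐 → 𝟐
ev-id R = R id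

mosˡ : (X : Set) → 𝒞 X × 𝒫 X → 𝟐
mosˡ X (Q , c) = Q c

data Perm2 : Set where
  ι τ : Perm2

Xσ₁ Xσ₂ : Perm2 → Set → Set → Set
Xσ₁ ι X₁ X₂ = X₁
Xσ₁ τ X₁ X₂ = X₂
Xσ₂ ι X₁ X₂ = X₂
Xσ₂ τ X₁ X₂ = X₁

Qσ₁ : (σ : Perm2) {X₁ X₂ : Set} → 𝒞 X₁ → 𝒞 X₂ → 𝒞 (Xσ₁ σ X₁ X₂)
Qσ₁ ι Q₁ Q₂ = Q₁
Qσ₁ τ Q₁ Q₂ = Q₂

Qσ₂ : (σ : Perm2) {X₁ X₂ : Set} → 𝒞 X₁ → 𝒞 X₂ → 𝒞 (Xσ₂ σ X₁ X₂)
Qσ₂ ι Q₁ Q₂ = Q₂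
Qσ₂ τ Q₁ Q₂ = Q₁

ρ : (σ : Perm2) {X₁ X₂ : Set} → Xσ₁ σ X₁ X₂ × Xσ₂ σ X₁ X₂ → X₁ × X₂
ρ ι (a , b) = (a , b)
ρ τ (a , b) = (b , a)

stratA : (σ : Perm2) {X₁ X₂ : Set} → 𝒞 X₁ → 𝒫 (X₁ × X₂) → 𝒞 X₂ → 𝟐
stratA σ Q₁ P Q₂ =
  Qσ₁ σ Q₁ Q₂ (λ a → Qσ₂ σ Q₁ Q₂ (λ b → P (ρ σ (a , b))))

stratB : (σ : Perm2) {X₁ X₂ : Set} → 𝒞 X₁ → 𝒫 (X₁ × X₂) → 𝒞 X₂ → 𝟐
stratB σ {X₁} {X₂} Q₁ P Q₂ =
  mosˡ (X₁ × X₂) (𝒞map (ρ σ) (pu l (Qσ₁ σ Q₁ Q₂) (Qσ₂ σ Q₁ Q₂)) , P)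

stratC : (ε ε'' : Side) {X₁ X₂ : Set} → 𝒞 X₁ → 𝒫 (X₁ × X₂) → 𝒞 X₂ → 𝟐
stratC ε ε'' {X₁} {X₂} Q₁ P Q₂ =
  ev-id (cps ε (evʳ X₁)
    (Q₁ , cps ε'' (evˡ X₁ X₂) (η (𝒫 (X₁ × X₂)) P , Q₂)))

-- Every strategy unfolds, by β-reduction alone, to nested applications of the
-- two quantifiers to P. The one point to see is that the verb phrase
-- cps^{ε''}(ε^l)(η P, Q₂) does not depend on ε'': a pile-up with a unit η on
-- one side gives the same result in either order. The scope order is then
-- decided by the outer ε alone, l giving subject-wide scope and r object-wide.
module Submission where

open import Defs
open import Data.Product using (_×_; _,_)
open import Relation.Binary.PropositionalEquality using (_≡_; refl; sym; cong)

verbPhrase : {X₁ X₂ : Set} → 𝒫 (X₁ × X₂) → 𝒞 X₂ → 𝒞 (𝒫 X₁)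
verbPhrase P Q₂ = λ k → Q₂ (λ y → k (λ x → P (x , y)))

cps-evˡ-η≡verbPhrase : (ε'' : Side) {X₁ X₂ : Set} (P : 𝒫 (X₁ × X₂)) (Q₂ : 𝒞 X₂) →
                       cps ε'' (evˡ X₁ X₂) (η (𝒫 (X₁ × X₂)) P , Q₂) ≡ verbPhrase P Q₂
cps-evˡ-η≡verbPhrase l P Q₂ = refl
cps-evˡ-η≡verbPhrase r P Q₂ = refl

stratC-verbPhrase : (ε ε'' : Side) {X₁ X₂ : Set}
                    (Q₁ : 𝒞 X₁) (P : 𝒫 (X₁ × X₂)) (Q₂ : 𝒞 X₂) →
                    stratC ε ε'' Q₁ P Q₂ ≡ ev-id (cps ε (evʳ X₁) (Q₁ , verbPhrase P Q₂))
stratC-verbPhrase ε ε'' {X₁} Q₁ P Q₂ =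
  cong (λ V → ev-id (cps ε (evʳ X₁) (Q₁ , V))) (cps-evˡ-η≡verbPhrase ε'' P Q₂)

stratA≡stratB : (σ : Perm2) {X₁ X₂ : Set}
                (Q₁ : 𝒞 X₁) (P : 𝒫 (X₁ × X₂)) (Q₂ : 𝒞 X₂) →
                stratA σ Q₁ P Q₂ ≡ stratB σ Q₁ P Q₂
stratA≡stratB ι Q₁ P Q₂ = refl
stratA≡stratB τ Q₁ P Q₂ = refl

stratB-ι≡stratC-l : (ε'' : Side) {X₁ X₂ : Set}
                    (Q₁ : 𝒞 X₁) (P : 𝒫 (X₁ × X₂)) (Q₂ : 𝒞 X₂) →
                    stratB ι Q₁ P Q₂ ≡ stratC l ε'' Q₁ P Q₂
stratB-ι≡stratC-l ε'' Q₁ P Q₂ = sym (stratC-verbPhrase l ε'' Q₁ P Q₂)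

stratB-τ≡stratC-r : (ε'' : Side) {X₁ X₂ : Set}
                    (Q₁ : 𝒞 X₁) (P : 𝒫 (X₁ × X₂)) (Q₂ : 𝒞 X₂) →
                    stratB τ Q₁ P Q₂ ≡ stratC r ε'' Q₁ P Q₂
stratB-τ≡stratC-r ε'' Q₁ P Q₂ = sym (stratC-verbPhrase r ε'' Q₁ P Q₂)

mainTheorem6 : (X₁ X₂ : Set) →
    ((σ : Perm2) → (Q₁ : 𝒞 X₁) (P : 𝒫 (X₁ × X₂)) (Q₂ : 𝒞 X₂) →
      stratA σ Q₁ P Q₂ ≡ stratB σ Q₁ P Q₂)
    × ((ε'' : Side) → (Q₁ : 𝒞 X₁) (P : 𝒫 (X₁ × X₂)) (Q₂ : 𝒞 X₂) →
      stratB ι Q₁ P Q₂ ≡ stratC l ε'' Q₁ P Q₂)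
    × ((ε'' : Side) → (Q₁ : 𝒞 X₁) (P : 𝒫 (X₁ × X₂)) (Q₂ : 𝒞 X₂) →
      stratB τ Q₁ P Q₂ ≡ stratC r ε'' Q₁ P Q₂)
mainTheorem6 X₁ X₂ = (λ σ → stratA≡stratB σ)
                   , (λ ε'' → stratB-ι≡stratC-l ε'')
                   , (λ ε'' → stratB-τ≡stratC-r ε'')
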